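{- Let $(\mathcal{C},\times,1)$ be a small cartesian monoidal category. Then the final fixpoint of the equation $$Q(\mathbf{X},\mathbf{Y})\cong\int^{M\in\mathcal{C}}\mathcal{C}(X_0,M\times Y_0)\times Q(M\cdot\mathbf{X}^+,\mathbf{Y}^+)$$ is given by the sets of causal functions, $$\mathrm{STREAM}(\mathbf{X},\mathbf{Y})\cong\prod_{n\in\mathbb{N}}\mathcal{C}(X_0\times\dots\times X_n,\ Y_n).$$ Moreover, under these bijections, the symmetric monoidal category $\mathrm{STREAM}$ of monoidal streams over $\mathcal{C}$ coincides with the cokleisli monoidal category of the non-empty list comonad $\mathrm{List}^+\colon\mathcal{C}^{\mathbb{N}}\to\mathcal{C}^{\mathbb{N}}$.
   Context: $\mathcal{C}^{\mathbb{N}}$: sequences $\mathbf{X}=(X_0,X_1,\dots)$ of objects with componentwise morphisms; $\mathbf{X}^+=(X_1,X_2,\dots)$; $M\cdot\mathbf{X}=(M\times X_0,X_1,\dots)$. Composition in diagrammatic order $;$. $\mathrm{STREAM}(\mathbf{X},\mathbf{Y})$ denotes the final fixpoint above (monoidal streams); a stream has a memory $M(f)$, a first action $\mathrm{now}(f)\colon X_0\to M(f)\times Y_0$ and a rest $\mathrm{later}(f)\in\mathrm{STREAM}(M(f)\cdot\mathbf{X}^+,\mathbf{Y}^+)$, quotiented coinductively by: $f\sim g$ if there is $r\colon M(g)\to M(f)$ with $\mathrm{now}(f)=\mathrm{now}(g);(r\times1)$ and $r\cdot\mathrm{later}(f)\sim\mathrm{later}(g)$ ($r\cdot h$ precomposes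 the first action of $h$ with $r\times1$). Its category structure: composition has memory $M(f)\times M(g)$, first action $\mathrm{now}(f)$ followed by $\mathrm{now}(g)$, rest the composite of the rests (with memories carried along); identities have memory $1$; tensor has memory $M(f)\times M(g)$, first action $\mathrm{now}(f)\times\mathrm{now}(g)$ up to symmetries, rest the tensor of the rests. $\mathrm{List}^+(\mathbf{X})_n=X_0\times\dots\times X_n$; it is a comonad with counit the projections $X_0\times\dots\times X_n\to X_n$ and comultiplication $X_0\times\dots\times X_n\to\prod_{i=0}^n(X_0\times\dots\times X_i)$ built from copying and projections. Its cokleisli category has morphisms $\mathbf{X}\to\mathbf{Y}$ the families $f_n\colon X_0\times\dots\times X_n\to Y_n$, composition $(f;g)_n=\langle f_0\circ\pi_{\le0},\dots,f_n\circ\pi_{\le n}\rangle;g_n$ (where $\pi_{\le i}$ projects onto the first $i+1$ factors), and monoidal structure componentwise. -}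

module Defs where

open import Data.Nat using (ℕ; zero; suc)
open import Level using (0ℓ)
open import Relation.Binary.Core using (Rel)
open import Relation.Binary.Structures using (IsEquivalence)
open import Relation.Binary.Construct.Closure.Equivalence using (EqClosure)

-- A small cartesian (monoidal) category (C, ×, 1).
-- Hom-sets are setoids (the usual convention in Agda without quotients);
-- composition is written in diagrammatic order  f ⨾ g  (= f ; g).

record CartesianCategory : Set₁ where
  infixr 9 _⨾_
  infix  4 _≈_
  field
    Obj : Set
    Hom : Obj → Obj → Set
    _≈_ : ∀ {A B} → Rel (Hom A B) 0ℓ
    ≈-isEquivalence : ∀ {A B} → IsEquivalence (_≈_ {A} {B})
    id  : ∀ {A} → Hom A A
    _⨾_ : ∀ {A B C} → Hom A B → Hom B C → Hom A C
    ⨾-cong : ∀ {A B C} {f f' : Hom A B} {g g' : Hom B C} →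
             f ≈ f' → g ≈ g' → f ⨾ g ≈ f' ⨾ g'
    identityˡ : ∀ {A B} {f : Hom A B} → id ⨾ f ≈ f
    identityʳ : ∀ {A B} {f : Hom A B} → f ⨾ id ≈ f
    assoc : ∀ {A B C D} {f : Hom A B} {g : Hom B C} {h : Hom C D} →
            (f ⨾ g) ⨾ h ≈ f ⨾ (g ⨾ h)
    𝟙 : Obj
    ! : ∀ {A} → Hom A 𝟙
    !-unique : ∀ {A} (f : Hom A 𝟙) → f ≈ !
    _×_ : Obj → Obj → Obj
    π₁ : ∀ {A B} → Hom (A × B) A
    π₂ : ∀ {A B} → Hom (A × B) B
    ⟨_,_⟩ : ∀ {C A B} → Hom C A → Hom C B → Hom C (A × B)
    ⟨⟩-cong : ∀ {C A B} {f f' : Hom C A} {g g' : Hom C B} →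
              f ≈ f' → g ≈ g' → ⟨ f , g ⟩ ≈ ⟨ f' , g' ⟩
    π₁-β : ∀ {C A B} {f : Hom C A} {g : Hom C B} → ⟨ f , g ⟩ ⨾ π₁ ≈ f
    π₂-β : ∀ {C A B} {f : Hom C A} {g : Hom C B} → ⟨ f , g ⟩ ⨾ π₂ ≈ g
    ⟨⟩-unique : ∀ {C A B} {f : Hom C A} {g : Hom C B} {h : Hom C (A × B)} →
                h ⨾ π₁ ≈ f → h ⨾ π₂ ≈ g → h ≈ ⟨ f , g ⟩

  infixr 7 _×₁_
  _×₁_ : ∀ {A B A' B'} → Hom A A' → Hom B B' → Hom (A × B) (A' × B')
  f ×₁ g = ⟨ π₁ ⨾ f , π₂ ⨾ g ⟩

module Streams (𝒞 : CartesianCategory) where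
  open CartesianCategory 𝒞

  Seq : Set
  Seq = ℕ → Obj

  _⁺ : Seq → Seq
  X ⁺ = λ n → X (suc n)

  infixr 6 _·_
  _·_ : Obj → Seq → Seq
  (M · X) zero    = M × X zero
  (M · X) (suc n) = X (suc n)

  infixr 7 _⊗_
  _⊗_ : Seq → Seq → Seq
  (X ⊗ X') n = X n × X' n

  I : Seq
  I _ = 𝟙

  -- Coinductively, a stream f : X → Y has a memory M(f), a first action
  -- now(f) : X₀ → M(f) × Y₀ and a rest later(f) : M(f)·X⁺ → Y⁺.  Since
  -- coinduction (--guardedness) is not available, we use the fully unfolded
  -- form of this final coalgebra, which is the same data: a sequence of
  -- memories mem n (mem 0 = M(f), mem 1 = M(later f), …), the first action
  --   first  : X₀ → mem 0 × Y₀                      (= now f)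
  -- and the first actions of the iterated rests
  --   step n : mem n × Xₙ₊₁ → mem (n+1) × Yₙ₊₁      (= now (laterⁿ⁺¹ f)).

  record Stream (X Y : Seq) : Set where
    field
      mem   : ℕ → Obj
      first : Hom (X zero) (mem zero × Y zero)
      step  : ∀ n → Hom (mem n × X (suc n)) (mem (suc n) × Y (suc n))
  open Stream public

  -- The dinaturality relation, defined coinductively in the paper by
  --   f ∼ g  iff  ∃ r : M(g) → M(f),  now f = now g ; (r × 1)
  --               and  r · later f ∼ later g,
  -- where r · h precomposes the first action of h with r × 1.
  -- Unfolded: a family rₙ : mem g n → mem f n with
  --   first f = first g ; (r₀ × 1)
  --   (rₙ × 1) ; step f n = step g n ; (rₙ₊₁ × 1).
  record _∼_ {X Y : Seq} (f g : Stream X Y) : Set where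
    field
      r        : ∀ n → Hom (mem g n) (mem f n)
      first-eq : first f ≈ first g ⨾ (r zero ×₁ id)
      step-eq  : ∀ n → (r n ×₁ id) ⨾ step f n ≈ step g n ⨾ (r (suc n) ×₁ id)
  open _∼_ public

  -- equality of STREAM(X,Y): the equivalence relation generated by ∼
  -- (STREAM(X,Y) is the quotient  Stream X Y / _≈ₛ_ , presented as a setoid)
  infix 4 _≈ₛ_
  _≈ₛ_ : ∀ {X Y : Seq} → Rel (Stream X Y) 0ℓ
  _≈ₛ_ = EqClosure _∼_

  idS : ∀ {X : Seq} → Stream X X
  mem   idS _ = 𝟙
  first idS   = ⟨ ! , id ⟩
  step  idS _ = ⟨ ! , π₂ ⟩

  infixr 9 _⨾ₛ_
  _⨾ₛ_ : ∀ {X Y Z : Seq} → Stream X Y → Stream Y Z → Stream X Z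
  mem   (f ⨾ₛ g) n = mem f n × mem g n
  first (f ⨾ₛ g) =
    let u = first f
        v = (u ⨾ π₂) ⨾ first g
    in ⟨ ⟨ u ⨾ π₁ , v ⨾ π₁ ⟩ , v ⨾ π₂ ⟩
  step  (f ⨾ₛ g) n =
    let u = ⟨ π₁ ⨾ π₁ , π₂ ⟩ ⨾ step f n
        v = ⟨ π₁ ⨾ π₂ , u ⨾ π₂ ⟩ ⨾ step g n
    in ⟨ ⟨ u ⨾ π₁ , v ⨾ π₁ ⟩ , v ⨾ π₂ ⟩

  infixr 7 _⊗ₛ_
  _⊗ₛ_ : ∀ {X X' Y Y' : Seq} → Stream X Y → Stream X' Y' → Stream (X ⊗ X') (Y ⊗ Y')
  mem   (f ⊗ₛ g) n = mem f n × mem g n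
  first (f ⊗ₛ g) =
    let u = π₁ ⨾ first f
        v = π₂ ⨾ first g
    in ⟨ ⟨ u ⨾ π₁ , v ⨾ π₁ ⟩ , ⟨ u ⨾ π₂ , v ⨾ π₂ ⟩ ⟩
  step  (f ⊗ₛ g) n =
    let u = ⟨ π₁ ⨾ π₁ , π₂ ⨾ π₁ ⟩ ⨾ step f n
        v = ⟨ π₁ ⨾ π₂ , π₂ ⨾ π₂ ⟩ ⨾ step g n
    in ⟨ ⟨ u ⨾ π₁ , v ⨾ π₁ ⟩ , ⟨ u ⨾ π₂ , v ⨾ π₂ ⟩ ⟩

  -- memoryless streams lifting a componentwise morphism h : X → Y of C^ℕ
  -- (the structural isomorphisms — associators, unitors, symmetries — of
  -- STREAM are of this form)
  pureS : ∀ {X Y : Seq} → (∀ n → Hom (X n) (Y n)) → Stream X Y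
  mem   (pureS h) _ = 𝟙
  first (pureS h)   = ⟨ ! , h zero ⟩
  step  (pureS h) n = ⟨ ! , π₂ ⨾ h (suc n) ⟩

  List⁺ : Seq → Seq
  List⁺ X zero    = X zero
  List⁺ X (suc n) = List⁺ X n × X (suc n)

  Causal : Seq → Seq → Set
  Causal X Y = (n : ℕ) → Hom (List⁺ X n) (Y n)

  infix 4 _≐_
  _≐_ : ∀ {X Y : Seq} → Rel (Causal X Y) 0ℓ
  f ≐ g = ∀ n → f n ≈ g n

  idC : ∀ {X : Seq} → Causal X X
  idC zero    = id
  idC (suc n) = π₂

  collect : ∀ {X Y : Seq} → Causal X Y → (n : ℕ) → Hom (List⁺ X n) (List⁺ Y n)
  collect f zero    = f zero
  collect f (suc n) = ⟨ π₁ ⨾ collect f n , f (suc n) ⟩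

  compC : ∀ {X Y Z : Seq} → Causal X Y → Causal Y Z → Causal X Z
  compC f g n = collect f n ⨾ g n

  unzipˡ : ∀ {X X' : Seq} (n : ℕ) → Hom (List⁺ (X ⊗ X') n) (List⁺ X n)
  unzipˡ zero    = π₁
  unzipˡ (suc n) = ⟨ π₁ ⨾ unzipˡ n , π₂ ⨾ π₁ ⟩

  unzipʳ : ∀ {X X' : Seq} (n : ℕ) → Hom (List⁺ (X ⊗ X') n) (List⁺ X' n)
  unzipʳ zero    = π₂
  unzipʳ (suc n) = ⟨ π₁ ⨾ unzipʳ n , π₂ ⨾ π₂ ⟩

  tensC : ∀ {X X' Y Y' : Seq} → Causal X Y → Causal X' Y' → Causal (X ⊗ X') (Y ⊗ Y')
  tensC f g n = ⟨ unzipˡ n ⨾ f n , unzipʳ n ⨾ g n ⟩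

  pureC : ∀ {X Y : Seq} → (∀ n → Hom (X n) (Y n)) → Causal X Y
  pureC h n = idC n ⨾ h n

-- Running a stream f on its first n+1 inputs gives a morphism
-- run f n : X₀ × ⋯ × Xₙ → Mₙ × Yₙ (current memory and output), whose output
-- components form the causal function of f.  Relabelling memories along
-- r : M(g) → M(f) only post-composes run with rₙ × 1, so outputs are invariant.
-- Conversely, every stream f is related to the stream whose memory is the whole
-- input history, the relating maps being the memory components of run f; and
-- that stream depends only on the causal function.  Composition and tensor are
-- preserved because the memory of a composite (tensor) after n+1 steps is the
-- pair of the memories of its parts, fed with the collected outputs of the
-- first (with the unzipped inputs).

module Submission where

open import Defs
open import Data.Nat using (ℕ; zero; suc)
open import Relation.Binary.Structures using (IsEquivalence)
open import Relation.Binary.Bundles using (Setoid)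
open import Relation.Binary.Construct.Closure.ReflexiveTransitive using (ε; _◅_)
open import Relation.Binary.Construct.Closure.Symmetric using (fwd; bwd)
import Relation.Binary.Reasoning.Setoid as SetoidReasoning

module CartesianProperties (𝒞 : CartesianCategory) where
  open CartesianCategory 𝒞

  private
    variable
      A B C D E : Obj

  module ≈-Equivalence {A B : Obj} = IsEquivalence (≈-isEquivalence {A} {B})
  open ≈-Equivalence public using ()
    renaming (refl to ≈-refl; sym to ≈-sym; trans to ≈-trans)

  hom-setoid : Obj → Obj → Setoid _ _
  hom-setoid A B = record { isEquivalence = ≈-isEquivalence {A} {B} }

  module HomReasoning {A B : Obj} = SetoidReasoning (hom-setoid A B)

  ⨾-congˡ : {f : Hom A B} {g g' : Hom B C} → g ≈ g' → f ⨾ g ≈ f ⨾ g'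
  ⨾-congˡ p = ⨾-cong ≈-refl p

  ⨾-congʳ : {f f' : Hom A B} {g : Hom B C} → f ≈ f' → f ⨾ g ≈ f' ⨾ g
  ⨾-congʳ p = ⨾-cong p ≈-refl

  sym-assoc : {f : Hom A B} {g : Hom B C} {h : Hom C D} → f ⨾ (g ⨾ h) ≈ (f ⨾ g) ⨾ h
  sym-assoc = ≈-sym assoc

  pullˡ : {f : Hom A B} {g : Hom B C} {h : Hom A C} {k : Hom C D} →
          f ⨾ g ≈ h → f ⨾ (g ⨾ k) ≈ h ⨾ k
  pullˡ e = ≈-trans sym-assoc (⨾-congʳ e)

  ⨾-distribˡ-⟨⟩ : {f : Hom A B} {g : Hom B C} {h : Hom B D} →
                  f ⨾ ⟨ g , h ⟩ ≈ ⟨ f ⨾ g , f ⨾ h ⟩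
  ⨾-distribˡ-⟨⟩ = ⟨⟩-unique (≈-trans assoc (⨾-congˡ π₁-β)) (≈-trans assoc (⨾-congˡ π₂-β))

  ⟨⟩-η : {h : Hom A (B × C)} → ⟨ h ⨾ π₁ , h ⨾ π₂ ⟩ ≈ h
  ⟨⟩-η = ≈-sym (⟨⟩-unique ≈-refl ≈-refl)

  ⟨π₁,π₂⟩≈id : ⟨ π₁ , π₂ ⟩ ≈ id {A × B}
  ⟨π₁,π₂⟩≈id = ≈-sym (⟨⟩-unique identityˡ identityˡ)

  ⟨⟩⨾π₁⨾ : {f : Hom A B} {g : Hom A C} {k : Hom B D} → ⟨ f , g ⟩ ⨾ (π₁ ⨾ k) ≈ f ⨾ k
  ⟨⟩⨾π₁⨾ = ≈-trans sym-assoc (⨾-congʳ π₁-β)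

  ⟨⟩⨾π₂⨾ : {f : Hom A B} {g : Hom A C} {k : Hom C D} → ⟨ f , g ⟩ ⨾ (π₂ ⨾ k) ≈ g ⨾ k
  ⟨⟩⨾π₂⨾ = ≈-trans sym-assoc (⨾-congʳ π₂-β)

  ⟨⟩⨾×₁ : {f : Hom A B} {g : Hom A C} {a : Hom B D} {b : Hom C E} →
          ⟨ f , g ⟩ ⨾ (a ×₁ b) ≈ ⟨ f ⨾ a , g ⨾ b ⟩
  ⟨⟩⨾×₁ = ≈-trans ⨾-distribˡ-⟨⟩ (⟨⟩-cong ⟨⟩⨾π₁⨾ ⟨⟩⨾π₂⨾)

  ⟨⟩⨾×₁id : {f : Hom A B} {g : Hom A C} {a : Hom B D} →
            ⟨ f , g ⟩ ⨾ (a ×₁ id) ≈ ⟨ f ⨾ a , g ⟩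
  ⟨⟩⨾×₁id = ≈-trans ⟨⟩⨾×₁ (⟨⟩-cong ≈-refl identityʳ)

  ×₁id-congˡ : {a a' : Hom A B} → a ≈ a' → a ×₁ id {C} ≈ a' ×₁ id
  ×₁id-congˡ p = ⟨⟩-cong (⨾-congˡ p) ≈-refl

  ×₁id-⨾ : {a : Hom A B} {b : Hom B C} → (a ×₁ id {D}) ⨾ (b ×₁ id) ≈ (a ⨾ b) ×₁ id
  ×₁id-⨾ = ≈-trans ⟨⟩⨾×₁id (⟨⟩-cong assoc ≈-refl)

  id×₁id : id {A} ×₁ id {B} ≈ id
  id×₁id = ≈-trans (⟨⟩-cong identityʳ identityʳ) ⟨π₁,π₂⟩≈id

  ×₁id⨾π₂ : {a : Hom A B} → (a ×₁ id {C}) ⨾ π₂ ≈ π₂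
  ×₁id⨾π₂ = ≈-trans π₂-β identityʳ

  ⟨id,⨾π₂⟩⨾⨾π₁×₁id : {h : Hom A (B × C)} → ⟨ id , h ⨾ π₂ ⟩ ⨾ ((h ⨾ π₁) ×₁ id) ≈ h
  ⟨id,⨾π₂⟩⨾⨾π₁×₁id = ≈-trans ⟨⟩⨾×₁id (≈-trans (⟨⟩-cong identityˡ ≈-refl) ⟨⟩-η)

module StreamsAsCausalFunctions (𝒞 : CartesianCategory) where
  open CartesianCategory 𝒞
  open CartesianProperties 𝒞
  open HomReasoning
  open Streams 𝒞

  private
    variable
      X X' Y Y' Z : Seq

  run : (f : Stream X Y) (n : ℕ) → Hom (List⁺ X n) (mem f n × Y n)
  state : (f : Stream X Y) (n : ℕ) → Hom (List⁺ X n) (mem f n)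

  run f zero    = first f
  run f (suc n) = (state f n ×₁ id) ⨾ step f n

  state f n = run f n ⨾ π₁

  toCausal : Stream X Y → Causal X Y
  toCausal f n = run f n ⨾ π₂

  ⟨⟩⨾run-suc : ∀ {A} (f : Stream X Y) (n : ℕ) {a : Hom A (List⁺ X n)} {x : Hom A (X (suc n))} →
               ⟨ a , x ⟩ ⨾ run f (suc n) ≈ ⟨ a ⨾ state f n , x ⟩ ⨾ step f n
  ⟨⟩⨾run-suc f n = ≈-trans sym-assoc (⨾-congʳ ⟨⟩⨾×₁id)

  step≈run-suc : ∀ {A B} (f : Stream X Y) (n : ℕ)
                 {a : Hom A (List⁺ X n)} {m : Hom A (mem f n)} {x : Hom (A × B) (X (suc n))} →
                 m ≈ a ⨾ state f n → ⟨ π₁ ⨾ m , x ⟩ ⨾ step f n ≈ ⟨ π₁ ⨾ a , x ⟩ ⨾ run f (suc n)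
  step≈run-suc f n m≈ = ≈-sym (≈-trans (⟨⟩⨾run-suc f n)
    (⨾-congʳ (⟨⟩-cong (≈-trans assoc (⨾-congˡ (≈-sym m≈))) ≈-refl)))

  run-resp-∼ : {f g : Stream X Y} (p : f ∼ g) (n : ℕ) → run f n ≈ run g n ⨾ (r p n ×₁ id)
  run-resp-∼ p zero = first-eq p
  run-resp-∼ {f = f} {g} p (suc n) = begin
      (state f n ×₁ id) ⨾ step f n
    ≈⟨ ⨾-congʳ (×₁id-congˡ state-f≈) ⟩
      ((state g n ⨾ r p n) ×₁ id) ⨾ step f n
    ≈⟨ ⨾-congʳ ×₁id-⨾ ⟨
      ((state g n ×₁ id) ⨾ (r p n ×₁ id)) ⨾ step f n
    ≈⟨ assoc ⟩
      (state g n ×₁ id) ⨾ ((r p n ×₁ id) ⨾ step f n)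
    ≈⟨ ⨾-congˡ (step-eq p n) ⟩
      (state g n ×₁ id) ⨾ (step g n ⨾ (r p (suc n) ×₁ id))
    ≈⟨ sym-assoc ⟩
      run g (suc n) ⨾ (r p (suc n) ×₁ id)
    ∎
    where
    state-f≈ : state f n ≈ state g n ⨾ r p n
    state-f≈ = ≈-trans (⨾-congʳ (run-resp-∼ p n)) (≈-trans assoc (≈-trans (⨾-congˡ π₁-β) sym-assoc))

  toCausal-resp-∼ : {f g : Stream X Y} → f ∼ g → toCausal f ≐ toCausal g
  toCausal-resp-∼ p n = ≈-trans (⨾-congʳ (run-resp-∼ p n)) (≈-trans assoc (⨾-congˡ ×₁id⨾π₂))

  toCausal-resp-≈ₛ : {f g : Stream X Y} → f ≈ₛ g → toCausal f ≐ toCausal g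
  toCausal-resp-≈ₛ ε           n = ≈-refl
  toCausal-resp-≈ₛ (fwd p ◅ q) n = ≈-trans (toCausal-resp-∼ p n) (toCausal-resp-≈ₛ q n)
  toCausal-resp-≈ₛ (bwd p ◅ q) n = ≈-trans (≈-sym (toCausal-resp-∼ p n)) (toCausal-resp-≈ₛ q n)

  historyStream : Causal X Y → Stream X Y
  mem   (historyStream {X} c) n = List⁺ X n
  first (historyStream c)       = ⟨ id , c zero ⟩
  step  (historyStream c) n     = ⟨ id , c (suc n) ⟩

  run-historyStream : (c : Causal X Y) (n : ℕ) → run (historyStream c) n ≈ ⟨ id , c n ⟩
  run-historyStream c zero    = ≈-refl
  run-historyStream c (suc n) = begin
      (state (historyStream c) n ×₁ id) ⨾ ⟨ id , c (suc n) ⟩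
    ≈⟨ ⨾-congʳ (×₁id-congˡ (≈-trans (⨾-congʳ (run-historyStream c n)) π₁-β)) ⟩
      (id ×₁ id) ⨾ ⟨ id , c (suc n) ⟩
    ≈⟨ ⨾-congʳ id×₁id ⟩
      id ⨾ ⟨ id , c (suc n) ⟩
    ≈⟨ identityˡ ⟩
      ⟨ id , c (suc n) ⟩
    ∎

  toCausal-historyStream : (c : Causal X Y) → toCausal (historyStream c) ≐ c
  toCausal-historyStream c n = ≈-trans (⨾-congʳ (run-historyStream c n)) π₂-β

  -- Both equations are the factorisation h = ⟨ id , h ⨾ π₂ ⟩ ⨾ ((h ⨾ π₁) × 1)
  -- for h = run f n.
  ∼-historyStream : (f : Stream X Y) → f ∼ historyStream (toCausal f)
  r        (∼-historyStream f) = state f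
  first-eq (∼-historyStream f) = ≈-sym ⟨id,⨾π₂⟩⨾⨾π₁×₁id
  step-eq  (∼-historyStream f) n = ≈-sym ⟨id,⨾π₂⟩⨾⨾π₁×₁id

  historyStream-resp-≐ : {c c' : Causal X Y} → c ≐ c' → historyStream c ∼ historyStream c'
  r        (historyStream-resp-≐ q) n = id
  first-eq (historyStream-resp-≐ q) =
    ≈-trans (⟨⟩-cong ≈-refl (q zero)) (≈-sym (≈-trans (⨾-congˡ id×₁id) identityʳ))
  step-eq  (historyStream-resp-≐ q) n =
    ≈-trans (⨾-congʳ id×₁id) (≈-trans identityˡ
      (≈-trans (⟨⟩-cong ≈-refl (q (suc n))) (≈-sym (≈-trans (⨾-congˡ id×₁id) identityʳ))))

  toCausal-injective : {f g : Stream X Y} → toCausal f ≐ toCausal g → f ≈ₛ g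
  toCausal-injective {f = f} {g} q =
    fwd (∼-historyStream f) ◅ fwd (historyStream-resp-≐ q) ◅ bwd (∼-historyStream g) ◅ ε

  toCausal-idS : toCausal (idS {X}) ≐ idC
  toCausal-idS zero    = π₂-β
  toCausal-idS (suc n) = ≈-trans assoc (≈-trans (⨾-congˡ π₂-β) ×₁id⨾π₂)

  toCausal-pureS : (h : ∀ n → Hom (X n) (Y n)) → toCausal (pureS h) ≐ pureC h
  toCausal-pureS h zero    = ≈-trans π₂-β (≈-sym identityˡ)
  toCausal-pureS h (suc n) =
    ≈-trans assoc (≈-trans (⨾-congˡ π₂-β) (≈-trans sym-assoc (⨾-congʳ ×₁id⨾π₂)))

  step-⨾ₛ : ∀ {A} (f : Stream X Y) (g : Stream Y Z) (n : ℕ)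
            {p : Hom A (mem f n × mem g n)} {x : Hom A (X (suc n))}
            {u : Hom A (mem f (suc n) × Y (suc n))} {v : Hom A (mem g (suc n) × Z (suc n))} →
            ⟨ p ⨾ π₁ , x ⟩ ⨾ step f n ≈ u →
            ⟨ p ⨾ π₂ , u ⨾ π₂ ⟩ ⨾ step g n ≈ v →
            ⟨ p , x ⟩ ⨾ step (f ⨾ₛ g) n ≈ ⟨ ⟨ u ⨾ π₁ , v ⨾ π₁ ⟩ , v ⨾ π₂ ⟩
  step-⨾ₛ f g n {p} {x} {u} {v} step-f step-g =
    ≈-trans ⨾-distribˡ-⟨⟩
      (⟨⟩-cong (≈-trans ⨾-distribˡ-⟨⟩ (⟨⟩-cong (pullˡ first-f) (pullˡ then-g))) (pullˡ then-g))
    where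
    first-f : ⟨ p , x ⟩ ⨾ (⟨ π₁ ⨾ π₁ , π₂ ⟩ ⨾ step f n) ≈ u
    first-f = ≈-trans (pullˡ (≈-trans ⨾-distribˡ-⟨⟩ (⟨⟩-cong ⟨⟩⨾π₁⨾ π₂-β))) step-f
    then-g : ⟨ p , x ⟩ ⨾ (⟨ π₁ ⨾ π₂ , (⟨ π₁ ⨾ π₁ , π₂ ⟩ ⨾ step f n) ⨾ π₂ ⟩ ⨾ step g n) ≈ v
    then-g = ≈-trans (pullˡ (≈-trans ⨾-distribˡ-⟨⟩ (⟨⟩-cong ⟨⟩⨾π₁⨾ (pullˡ first-f)))) step-g

  run-⨾ₛ : (f : Stream X Y) (g : Stream Y Z) (n : ℕ) →
           run (f ⨾ₛ g) n ≈ ⟨ ⟨ state f n , collect (toCausal f) n ⨾ state g n ⟩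
                            , collect (toCausal f) n ⨾ toCausal g n ⟩
  run-⨾ₛ f g zero    = ⟨⟩-cong (⟨⟩-cong ≈-refl assoc) assoc
  run-⨾ₛ f g (suc n) =
    ≈-trans (step-⨾ₛ f g n resume-f resume-g) (⟨⟩-cong (⟨⟩-cong ≈-refl assoc) assoc)
    where
    state-⨾ₛ : state (f ⨾ₛ g) n ≈ ⟨ state f n , collect (toCausal f) n ⨾ state g n ⟩
    state-⨾ₛ = ≈-trans (⨾-congʳ (run-⨾ₛ f g n)) π₁-β
    resume-f : ⟨ (π₁ ⨾ state (f ⨾ₛ g) n) ⨾ π₁ , π₂ ⨾ id ⟩ ⨾ step f n ≈ run f (suc n)
    resume-f = ⨾-congʳ (⟨⟩-cong (≈-trans assoc (⨾-congˡ (≈-trans (⨾-congʳ state-⨾ₛ) π₁-β))) ≈-refl)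
    resume-g : ⟨ (π₁ ⨾ state (f ⨾ₛ g) n) ⨾ π₂ , toCausal f (suc n) ⟩ ⨾ step g n
              ≈ collect (toCausal f) (suc n) ⨾ run g (suc n)
    resume-g = ≈-trans (⨾-congʳ (⟨⟩-cong assoc ≈-refl))
                        (step≈run-suc g n (≈-trans (⨾-congʳ state-⨾ₛ) π₂-β))

  toCausal-⨾ₛ : (f : Stream X Y) (g : Stream Y Z) → toCausal (f ⨾ₛ g) ≐ compC (toCausal f) (toCausal g)
  toCausal-⨾ₛ f g n = ≈-trans (⨾-congʳ (run-⨾ₛ f g n)) π₂-β

  step-⊗ₛ : ∀ {A} (f : Stream X Y) (g : Stream X' Y') (n : ℕ)
            {p : Hom A (mem f n × mem g n)} {x : Hom A (X (suc n) × X' (suc n))}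
            {u : Hom A (mem f (suc n) × Y (suc n))} {v : Hom A (mem g (suc n) × Y' (suc n))} →
            ⟨ p ⨾ π₁ , x ⨾ π₁ ⟩ ⨾ step f n ≈ u →
            ⟨ p ⨾ π₂ , x ⨾ π₂ ⟩ ⨾ step g n ≈ v →
            ⟨ p , x ⟩ ⨾ step (f ⊗ₛ g) n ≈ ⟨ ⟨ u ⨾ π₁ , v ⨾ π₁ ⟩ , ⟨ u ⨾ π₂ , v ⨾ π₂ ⟩ ⟩
  step-⊗ₛ f g n {p} {x} {u} {v} step-f step-g =
    ≈-trans ⨾-distribˡ-⟨⟩
      (⟨⟩-cong (≈-trans ⨾-distribˡ-⟨⟩ (⟨⟩-cong (pullˡ left) (pullˡ right)))
               (≈-trans ⨾-distribˡ-⟨⟩ (⟨⟩-cong (pullˡ left) (pullˡ right))))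
    where
    left : ⟨ p , x ⟩ ⨾ (⟨ π₁ ⨾ π₁ , π₂ ⨾ π₁ ⟩ ⨾ step f n) ≈ u
    left = ≈-trans (pullˡ (≈-trans ⨾-distribˡ-⟨⟩ (⟨⟩-cong ⟨⟩⨾π₁⨾ ⟨⟩⨾π₂⨾))) step-f
    right : ⟨ p , x ⟩ ⨾ (⟨ π₁ ⨾ π₂ , π₂ ⨾ π₂ ⟩ ⨾ step g n) ≈ v
    right = ≈-trans (pullˡ (≈-trans ⨾-distribˡ-⟨⟩ (⟨⟩-cong ⟨⟩⨾π₁⨾ ⟨⟩⨾π₂⨾))) step-g

  run-⊗ₛ : (f : Stream X Y) (g : Stream X' Y') (n : ℕ) →
           run (f ⊗ₛ g) n ≈ ⟨ ⟨ unzipˡ n ⨾ state f n , unzipʳ n ⨾ state g n ⟩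
                            , ⟨ unzipˡ n ⨾ toCausal f n , unzipʳ n ⨾ toCausal g n ⟩ ⟩
  run-⊗ₛ f g zero    = ⟨⟩-cong (⟨⟩-cong assoc assoc) (⟨⟩-cong assoc assoc)
  run-⊗ₛ f g (suc n) =
    ≈-trans (step-⊗ₛ f g n resume-f resume-g)
            (⟨⟩-cong (⟨⟩-cong assoc assoc) (⟨⟩-cong assoc assoc))
    where
    state-⊗ₛ : state (f ⊗ₛ g) n ≈ ⟨ unzipˡ n ⨾ state f n , unzipʳ n ⨾ state g n ⟩
    state-⊗ₛ = ≈-trans (⨾-congʳ (run-⊗ₛ f g n)) π₁-β
    resume-f : ⟨ (π₁ ⨾ state (f ⊗ₛ g) n) ⨾ π₁ , (π₂ ⨾ id) ⨾ π₁ ⟩ ⨾ step f n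
             ≈ unzipˡ (suc n) ⨾ run f (suc n)
    resume-f = ≈-trans (⨾-congʳ (⟨⟩-cong assoc (≈-trans assoc (⨾-congˡ identityˡ))))
                       (step≈run-suc f n (≈-trans (⨾-congʳ state-⊗ₛ) π₁-β))
    resume-g : ⟨ (π₁ ⨾ state (f ⊗ₛ g) n) ⨾ π₂ , (π₂ ⨾ id) ⨾ π₂ ⟩ ⨾ step g n
             ≈ unzipʳ (suc n) ⨾ run g (suc n)
    resume-g = ≈-trans (⨾-congʳ (⟨⟩-cong assoc (≈-trans assoc (⨾-congˡ identityˡ))))
                       (step≈run-suc g n (≈-trans (⨾-congʳ state-⊗ₛ) π₂-β))

  toCausal-⊗ₛ : (f : Stream X Y) (g : Stream X' Y') → toCausal (f ⊗ₛ g) ≐ tensC (toCausal f) (toCausal g)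
  toCausal-⊗ₛ f g n = ≈-trans (⨾-congʳ (run-⊗ₛ f g n)) π₂-β

open import Data.Product using (Σ; _×_; _,_)

theorem8p9 : (𝒞 : CartesianCategory) →
    let open CartesianCategory 𝒞 hiding (_×_)
        open Streams 𝒞
    in Σ (∀ {X Y : Seq} → Stream X Y → Causal X Y) λ Φ →
         (∀ {X Y : Seq} {f g : Stream X Y} → f ≈ₛ g → Φ f ≐ Φ g)
       × (∀ {X Y : Seq} {f g : Stream X Y} → Φ f ≐ Φ g → f ≈ₛ g)
       × (∀ {X Y : Seq} (c : Causal X Y) → Σ (Stream X Y) λ f → Φ f ≐ c)
       × (∀ {X : Seq} → Φ (idS {X}) ≐ idC)
       × (∀ {X Y Z : Seq} (f : Stream X Y) (g : Stream Y Z) → Φ (f ⨾ₛ g) ≐ compC (Φ f) (Φ g))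
       × (∀ {X X' Y Y' : Seq} (f : Stream X Y) (g : Stream X' Y') → Φ (f ⊗ₛ g) ≐ tensC (Φ f) (Φ g))
       × (∀ {X Y : Seq} (h : ∀ n → Hom (X n) (Y n)) → Φ (pureS h) ≐ pureC h)
theorem8p9 𝒞 =
    toCausal
  , toCausal-resp-≈ₛ
  , toCausal-injective
  , (λ c → historyStream c , toCausal-historyStream c)
  , toCausal-idS
  , toCausal-⨾ₛ
  , toCausal-⊗ₛ
  , toCausal-pureS
  where open StreamsAsCausalFunctions 𝒞
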